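{- If a polynomial $f \in \mathbb{N}_0[x^{\pm 1}]$ is hyper-monolithic, then $f$ is monolithic.
   Context: $\mathbb{N}_0[x^{\pm 1}]$ denotes the commutative semiring of Laurent polynomials in $x$ with nonnegative integer coefficients. A nonzero $f \in \mathbb{N}_0[x^{\pm 1}]$ is monolithic if whenever $f = gh$ with $g, h \in \mathbb{N}_0[x^{\pm 1}]$, at least one of $g$, $h$ is a monomial $c x^k$ ($c$ a positive integer, $k \in \mathbb{Z}$). Write $f = \sum_{i=0}^n c_i x^{k_i}$ with positive integers $c_i$ and integers $k_0 > \cdots > k_n$; $f$ is hyper-monolithic if $n \ge 1$ (i.e. $|\operatorname{supp}(f)| > 1$) and either $k_0 - k_1 < k_i - k_{i+1}$ for every $i \in \{1, \ldots, n-1\}$, or $k_{n-1} - k_n < k_j - k_{j+1}$ for every $j \in \{0, \ldots, n-2\}$. -}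

module Defs where

open import Data.Nat as ℕ using (ℕ; zero; suc)
open import Data.Integer as ℤ using (ℤ; +_; _-_)
open import Data.List using (List; []; _∷_; map)
open import Data.Product using (Σ; ∃; _×_; _,_)
open import Data.Sum using (_⊎_)
open import Relation.Binary.PropositionalEquality using (_≡_; _≢_)
open import Function.Bundles using (_⇔_)

-- Ordinary polynomials in ℕ₀[x] as coefficient lists (constant term first).
addP : List ℕ → List ℕ → List ℕ
addP []       q        = q
addP (a ∷ p)  []       = a ∷ p
addP (a ∷ p)  (b ∷ q)  = (a ℕ.+ b) ∷ addP p q

mulP : List ℕ → List ℕ → List ℕ
mulP []      q = []
mulP (a ∷ p) q = addP (map (a ℕ.*_) q) (0 ∷ mulP p q)

coeffP : List ℕ → ℕ → ℕ
coeffP []      _       = 0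
coeffP (a ∷ p) zero    = a
coeffP (a ∷ p) (suc i) = coeffP p i

-- A Laurent polynomial in ℕ₀[x^{±1}]:  x^shift · Σᵢ coeffs[i] xⁱ.
record Laurent : Set where
  constructor laurent
  field
    shift  : ℤ
    coeffs : List ℕ
open Laurent public

coeff : Laurent → ℤ → ℕ
coeff f k with k - shift f
... | + i      = coeffP (coeffs f) i
... | ℤ.-[1+ _ ] = 0

_·_ : Laurent → Laurent → Laurent
f · g = laurent (shift f ℤ.+ shift g) (mulP (coeffs f) (coeffs g))

_≈_ : Laurent → Laurent → Set
f ≈ g = ∀ k → coeff f k ≡ coeff g k

NonZero : Laurent → Set
NonZero f = ∃ λ k → coeff f k ≢ 0

IsMonomial : Laurent → Set
IsMonomial g = Σ ℕ λ c → Σ ℤ λ k →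
  (0 ℕ.< c) × (coeff g k ≡ c) × (∀ j → j ≢ k → coeff g j ≡ 0)

Monolithic : Laurent → Set
Monolithic f = NonZero f ×
  (∀ g h → f ≈ (g · h) → IsMonomial g ⊎ IsMonomial h)

-- f = Σ_{i=0}^{n} c_i x^{k_i}, c_i > 0, k_0 > ⋯ > k_n, with n = suc m ≥ 1.
-- The exponents are given by k : ℕ → ℤ (only the values k 0 … k n matter).
IsSupportEnum : Laurent → ℕ → (ℕ → ℤ) → Set
IsSupportEnum f n k =
  (∀ i → i ℕ.< n → k (suc i) ℤ.< k i) ×
  (∀ j → (coeff f j ≢ 0) ⇔ (∃ λ i → (i ℕ.≤ n) × (k i ≡ j)))

HyperMonolithic : Laurent → Set
HyperMonolithic f = Σ ℕ λ m → Σ (ℕ → ℤ) λ k →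
  IsSupportEnum f (suc m) k ×
  ( (∀ i → 1 ℕ.≤ i → i ℕ.< suc m → (k 0 - k 1) ℤ.< (k i - k (suc i)))
  ⊎ (∀ j → j ℕ.< m → (k m - k (suc m)) ℤ.< (k j - k (suc j))) )

{-# OPTIONS --safe #-}
module Submission where

-- On supports the factorisation f = g · h says supp f = supp g + supp h (a sumset in ℤ).
-- Let a₀, b₀ be the maxima of supp g, supp h, so the top exponent is k₀ = a₀ + b₀, and write
-- the next one as k₁ = a + b. Either a = a₀, or a < a₀ and then a + b₀ = k₁; by symmetry take
-- a + b₀ = k₁. Any further y ∈ supp h would give two exponents a₀ + y > a + y of f below k₀
-- differing by k₀ - k₁, whereas two exponents below k₀ differ by at least some later gap, which
-- is larger. Hence supp h = {b₀}. The other hyper-monolithic condition is the mirror image,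
-- reduced to this one by negating all exponents.

open import Defs
open import Data.Nat as ℕ using (ℕ; zero; suc; z≤n; s≤s)
import Data.Nat.Properties as ℕ
open import Data.Integer using (ℤ; +_; -[1+_]; _-_; _+_; -_; _<_; _≤_)
open import Data.Integer.Properties
open import Data.Integer.Tactic.RingSolver using (solve-∀)
open import Data.List using ([]; _∷_; map)
open import Data.Product using (Σ; ∃; ∃₂; _×_; _,_; proj₁; proj₂)
open import Data.Sum as Sum using (_⊎_; inj₁; inj₂)
open import Function using (_∘_)
open import Function.Bundles using (_⇔_; mk⇔; Equivalence)
open import Relation.Nullary using (¬_; yes; no; contradiction)
open import Relation.Nullary.Decidable using (decidable-stable)
open import Relation.Binary.PropositionalEquality

*-≢0 : ∀ {m n} → m ≢ 0 → n ≢ 0 → m ℕ.* n ≢ 0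
*-≢0 {m} m≢0 n≢0 mn≡0 = Sum.[ m≢0 , n≢0 ]′ (ℕ.m*n≡0⇒m≡0∨n≡0 m mn≡0)

coeffP-addP : ∀ p q n → coeffP (addP p q) n ≡ coeffP p n ℕ.+ coeffP q n
coeffP-addP []      q       n       = refl
coeffP-addP (a ∷ p) []      n       = sym (ℕ.+-identityʳ _)
coeffP-addP (a ∷ p) (b ∷ q) zero    = refl
coeffP-addP (a ∷ p) (b ∷ q) (suc n) = coeffP-addP p q n

coeffP-map-* : ∀ a q n → coeffP (map (a ℕ.*_) q) n ≡ a ℕ.* coeffP q n
coeffP-map-* a []      n       = sym (ℕ.*-zeroʳ a)
coeffP-map-* a (b ∷ q) zero    = refl
coeffP-map-* a (b ∷ q) (suc n) = coeffP-map-* a q n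

coeffP-mulP-∷ : ∀ a p q n →
  coeffP (mulP (a ∷ p) q) n ≡ a ℕ.* coeffP q n ℕ.+ coeffP (0 ∷ mulP p q) n
coeffP-mulP-∷ a p q n = begin
  coeffP (addP (map (a ℕ.*_) q) (0 ∷ mulP p q)) n            ≡⟨ coeffP-addP (map (a ℕ.*_) q) _ n ⟩
  coeffP (map (a ℕ.*_) q) n ℕ.+ coeffP (0 ∷ mulP p q) n     ≡⟨ cong (ℕ._+ _) (coeffP-map-* a q n) ⟩
  a ℕ.* coeffP q n ℕ.+ coeffP (0 ∷ mulP p q) n              ∎
  where open ≡-Reasoning

coeffP-mulP-≢0 : ∀ p q {i j} → coeffP p i ≢ 0 → coeffP q j ≢ 0 → coeffP (mulP p q) (i ℕ.+ j) ≢ 0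
coeffP-mulP-≢0 []      q         pᵢ≢0 _    = contradiction refl pᵢ≢0
coeffP-mulP-≢0 (a ∷ p) q {zero} {j} a≢0 qⱼ≢0 e =
  *-≢0 a≢0 qⱼ≢0 (ℕ.m+n≡0⇒m≡0 _ (trans (sym (coeffP-mulP-∷ a p q j)) e))
coeffP-mulP-≢0 (a ∷ p) q {suc i} {j} pᵢ≢0 qⱼ≢0 e =
  coeffP-mulP-≢0 p q pᵢ≢0 qⱼ≢0
    (ℕ.m+n≡0⇒n≡0 _ (trans (sym (coeffP-mulP-∷ a p q (suc (i ℕ.+ j)))) e))

coeffP-mulP-≢0⁻ : ∀ p q n → coeffP (mulP p q) n ≢ 0 →
  ∃₂ λ i j → i ℕ.+ j ≡ n × coeffP p i ≢ 0 × coeffP q j ≢ 0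
coeffP-mulP-≢0⁻ []      q n       pqₙ≢0 = contradiction refl pqₙ≢0
coeffP-mulP-≢0⁻ (a ∷ p) q n       pqₙ≢0 with a ℕ.* coeffP q n ℕ.≟ 0
coeffP-mulP-≢0⁻ (a ∷ p) q n       pqₙ≢0 | no aqₙ≢0 =
  0 , n , refl , (λ a≡0 → aqₙ≢0 (cong (ℕ._* _) a≡0)) ,
  λ qₙ≡0 → aqₙ≢0 (trans (cong (a ℕ.*_) qₙ≡0) (ℕ.*-zeroʳ a))
coeffP-mulP-≢0⁻ (a ∷ p) q zero    pqₙ≢0 | yes aqₙ≡0 =
  contradiction (trans (coeffP-mulP-∷ a p q 0) (cong (ℕ._+ 0) aqₙ≡0)) pqₙ≢0
coeffP-mulP-≢0⁻ (a ∷ p) q (suc n) pqₙ≢0 | yes aqₙ≡0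
  with coeffP-mulP-≢0⁻ p q n
         (λ e → pqₙ≢0 (trans (coeffP-mulP-∷ a p q (suc n)) (cong₂ ℕ._+_ aqₙ≡0 e)))
... | i , j , refl , pᵢ≢0 , qⱼ≢0 = suc i , j , refl , pᵢ≢0 , qⱼ≢0

Support : Laurent → ℤ → Set
Support f j = coeff f j ≢ 0

coeff-shift+ : ∀ f i → coeff f (shift f + + i) ≡ coeffP (coeffs f) i
coeff-shift+ f i with (shift f + + i) - shift f | [s+i]-s≡i (shift f) (+ i)
  where
  [s+i]-s≡i : ∀ s i → (s + i) - s ≡ i
  [s+i]-s≡i = solve-∀
... | .(+ i) | refl = refl

Support⇒shift+ : ∀ f {k} → Support f k → ∃ λ i → shift f + + i ≡ k × coeffP (coeffs f) i ≢ 0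
Support⇒shift+ f {k} fₖ≢0 with k - shift f in eq
... | + i      = i , trans (cong (λ x → shift f + x) (sym eq)) (s+[k-s]≡k (shift f) k) , fₖ≢0
  where
  s+[k-s]≡k : ∀ s k → s + (k - s) ≡ k
  s+[k-s]≡k = solve-∀
... | -[1+ _ ] = contradiction refl fₖ≢0

shift+-interchange : ∀ s t i j → (s + t) + + (i ℕ.+ j) ≡ (s + + i) + (t + + j)
shift+-interchange s t i j = trans (cong (λ x → (s + t) + x) (pos-+ i j)) (interchange s t (+ i) (+ j))
  where
  interchange : ∀ s t i j → (s + t) + (i + j) ≡ (s + i) + (t + j)
  interchange = solve-∀

Support-· : ∀ g h {a b} → Support g a → Support h b → Support (g · h) (a + b)
Support-· g h {a} {b} ga≢0 hb≢0 with Support⇒shift+ g {a} ga≢0 | Support⇒shift+ h {b} hb≢0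
... | i , refl , gᵢ≢0 | j , refl , hⱼ≢0 =
  subst (Support (g · h)) (shift+-interchange (shift g) (shift h) i j)
        (subst (_≢ 0) (sym (coeff-shift+ (g · h) (i ℕ.+ j)))
               (coeffP-mulP-≢0 (coeffs g) (coeffs h) gᵢ≢0 hⱼ≢0))

Support-·⁻ : ∀ g h {k} → Support (g · h) k → ∃₂ λ a b → Support g a × Support h b × a + b ≡ k
Support-·⁻ g h {k} ghₖ≢0 with Support⇒shift+ (g · h) {k} ghₖ≢0
... | n , refl , ghₙ≢0 with coeffP-mulP-≢0⁻ (coeffs g) (coeffs h) n ghₙ≢0
... | i , j , refl , gᵢ≢0 , hⱼ≢0 =
  shift g + + i , shift h + + j ,
  subst (_≢ 0) (sym (coeff-shift+ g i)) gᵢ≢0 ,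
  subst (_≢ 0) (sym (coeff-shift+ h j)) hⱼ≢0 ,
  sym (shift+-interchange (shift g) (shift h) i j)

+-cancelˡ-≤ : ∀ a {x y} → a + x ≤ a + y → x ≤ y
+-cancelˡ-≤ a {x} {y} le = subst₂ _≤_ (-a+[a+x]≡x a x) (-a+[a+x]≡x a y) (+-monoʳ-≤ (- a) le)
  where
  -a+[a+x]≡x : ∀ a x → - a + (a + x) ≡ x
  -a+[a+x]≡x = solve-∀

≡-difference⇒< : ∀ {x y u v} → x - y ≡ u - v → v < u → y < x
≡-difference⇒< {x} {y} {u} {v} eq v<u = subst₂ _<_ ([y-v]+v≡y y v) shifted (+-monoʳ-< (y - v) v<u)
  where
  open ≡-Reasoning
  [y-v]+v≡y : ∀ y v → (y - v) + v ≡ y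
  [y-v]+v≡y = solve-∀
  [y-v]+u≡y+[u-v] : ∀ y u v → (y - v) + u ≡ y + (u - v)
  [y-v]+u≡y+[u-v] = solve-∀
  y+[x-y]≡x : ∀ x y → y + (x - y) ≡ x
  y+[x-y]≡x = solve-∀
  shifted : (y - v) + u ≡ x
  shifted = begin
    (y - v) + u  ≡⟨ [y-v]+u≡y+[u-v] y u v ⟩
    y + (u - v)  ≡⟨ cong (λ d → y + d) (sym eq) ⟩
    y + (x - y)  ≡⟨ y+[x-y]≡x x y ⟩
    x            ∎

-x--y≡y-x : ∀ x y → - x - - y ≡ y - x
-x--y≡y-x = solve-∀

∸-suc : ∀ {i n} → i ℕ.< n → n ℕ.∸ i ≡ suc (n ℕ.∸ suc i)
∸-suc (s≤s i≤n) = ℕ.+-∸-assoc 1 i≤n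

record IsSumset (S A B : ℤ → Set) : Set where
  field
    split : ∀ {j} → S j → ∃₂ λ a b → A a × B b × a + b ≡ j
    add   : ∀ {a b} → A a → B b → S (a + b)

Support-sumset : ∀ {f g h} → f ≈ (g · h) → IsSumset (Support f) (Support g) (Support h)
Support-sumset {f} {g} {h} f≈gh = record
  { split = λ {j} fⱼ≢0 → Support-·⁻ g h {j} (fⱼ≢0 ∘ trans (f≈gh j))
  ; add   = λ {a} {b} ga≢0 hb≢0 → Support-· g h {a} {b} ga≢0 hb≢0 ∘ trans (sym (f≈gh (a + b)))
  }

IsSumset-swap : ∀ {S A B} → IsSumset S A B → IsSumset S B A
IsSumset-swap {S} sum = record
  { split = λ Sⱼ → let a , b , Aa , Bb , eq = split Sⱼ in b , a , Bb , Aa , trans (+-comm b a) eq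
  ; add   = λ {b} {a} Bb Aa → subst S (+-comm a b) (add Aa Bb)
  }
  where open IsSumset sum

IsSumset-neg : ∀ {S A B} → IsSumset S A B → IsSumset (S ∘ -_) (A ∘ -_) (B ∘ -_)
IsSumset-neg {S} {A} {B} sum = record
  { split = λ {j} S₋ⱼ → let a , b , Aa , Bb , eq = split S₋ⱼ in
      - a , - b , subst A (sym (neg-involutive a)) Aa , subst B (sym (neg-involutive b)) Bb ,
      trans (sym (neg-distrib-+ a b)) (trans (cong -_ eq) (neg-involutive j))
  ; add   = λ {a} {b} A₋a B₋b → subst S (sym (neg-distrib-+ a b)) (add A₋a B₋b)
  }
  where open IsSumset sum

IsSingleton : (ℤ → Set) → Set
IsSingleton A = Σ ℤ λ c → A c × (∀ j → j ≢ c → ¬ A j)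

IsSingleton-neg : ∀ {A} → IsSingleton (A ∘ -_) → IsSingleton A
IsSingleton-neg {A} (c , A₋c , others) =
  - c , A₋c , λ j j≢-c Aⱼ → others (- j) (λ -j≡c → j≢-c (trans (sym (neg-involutive j)) (cong -_ -j≡c)))
                                          (subst A (sym (neg-involutive j)) Aⱼ)

record IsolatedTopGap (S : ℤ → Set) : Set where
  field
    top next       : ℤ
    top∈           : S top
    next∈          : S next
    ≤top           : ∀ {j} → S j → j ≤ top
    <top⇒≤next     : ∀ {j} → S j → j < top → j ≤ next
    gap-unrealised : ∀ {x y} → S x → S y → x < top → x - y ≢ top - next

module _ {S A B : ℤ → Set} (sum : IsSumset S A B) (gap : IsolatedTopGap S) where
  open IsSumset sum
  open IsolatedTopGap gap

  ≤-summandʳ-of-top : ∀ {a₀ b₀ y} → A a₀ → a₀ + b₀ ≡ top → B y → y ≤ b₀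
  ≤-summandʳ-of-top {a₀} {b₀} {y} Aa₀ eq₀ By =
    +-cancelˡ-≤ a₀ (subst (a₀ + y ≤_) (sym eq₀) (≤top (add Aa₀ By)))

  -- If b₀ is paired with a₀ for the top and with some a for the next element, every other
  -- y ∈ B would realise the top gap as (a₀ + y) - (a + y).
  summandʳ-singleton : ∀ {a₀ b₀ a} → A a₀ → B b₀ → a₀ + b₀ ≡ top → A a → a + b₀ ≡ next →
                       IsSingleton B
  summandʳ-singleton {a₀} {b₀} {a} Aa₀ Bb₀ eq₀ Aa eq₁ = b₀ , Bb₀ , λ y y≢b₀ By →
    gap-unrealised (add Aa₀ By) (add Aa By) (a₀+y<top By y≢b₀) (differences y)
    where
    a₀+y<top : ∀ {y} → B y → y ≢ b₀ → a₀ + y < top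
    a₀+y<top By y≢b₀ =
      subst (a₀ + _ <_) eq₀ (+-monoʳ-< a₀ (≤∧≢⇒< (≤-summandʳ-of-top Aa₀ eq₀ By) y≢b₀))
    translate : ∀ a₀ a b₀ y → (a₀ + y) - (a + y) ≡ (a₀ + b₀) - (a + b₀)
    translate = solve-∀
    differences : ∀ y → (a₀ + y) - (a + y) ≡ top - next
    differences y = trans (translate a₀ a b₀ y) (cong₂ _-_ eq₀ eq₁)

sumset-singleton : ∀ {S A B} → IsSumset S A B → IsolatedTopGap S → IsSingleton A ⊎ IsSingleton B
sumset-singleton {A = A} {B = B} sum gap = from-decompositions (split top∈) (split next∈)
  where
  open IsSumset sum
  open IsolatedTopGap gap
  Decomposition : ℤ → Set
  Decomposition j = ∃₂ λ a b → A a × B b × a + b ≡ j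
  from-decompositions : Decomposition top → Decomposition next → IsSingleton A ⊎ IsSingleton B
  from-decompositions (a₀ , b₀ , Aa₀ , Bb₀ , eq₀) (a , b , Aa , Bb , eq₁) with a ≟ a₀
  ... | yes refl = inj₁ (summandʳ-singleton (IsSumset-swap sum) gap
                           Bb₀ Aa₀ (trans (+-comm b₀ a) eq₀) Bb (trans (+-comm b a) eq₁))
  ... | no a≢a₀ = inj₂ (summandʳ-singleton sum gap Aa₀ Bb₀ eq₀ Aa (≤-antisym a+b₀≤next next≤a+b₀))
    where
    a<a₀ : a < a₀
    a<a₀ = ≤∧≢⇒< (≤-summandʳ-of-top (IsSumset-swap sum) gap Bb₀ (trans (+-comm b₀ a₀) eq₀) Aa) a≢a₀
    a+b₀≤next : a + b₀ ≤ next
    a+b₀≤next = <top⇒≤next (add Aa Bb₀) (subst (a + b₀ <_) eq₀ (+-monoˡ-< b₀ a<a₀))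
    next≤a+b₀ : next ≤ a + b₀
    next≤a+b₀ = subst (_≤ a + b₀) eq₁ (+-monoʳ-≤ a (≤-summandʳ-of-top sum gap Aa₀ eq₀ Bb))

IsDecreasingEnumeration : (ℤ → Set) → ℕ → (ℕ → ℤ) → Set
IsDecreasingEnumeration S n k =
  (∀ i → i ℕ.< n → k (suc i) < k i) × (∀ j → S j ⇔ ∃ λ i → i ℕ.≤ n × k i ≡ j)

TopGapIsSmallest : ℕ → (ℕ → ℤ) → Set
TopGapIsSmallest n k = ∀ i → 1 ℕ.≤ i → i ℕ.< n → k 0 - k 1 < k i - k (suc i)

BottomGapIsSmallest : ℕ → (ℕ → ℤ) → Set
BottomGapIsSmallest m k = ∀ j → j ℕ.< m → k m - k (suc m) < k j - k (suc j)

module DecreasingEnumeration {S : ℤ → Set} {n : ℕ} {k : ℕ → ℤ} (enum : IsDecreasingEnumeration S n k)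
  where

  decreasing : ∀ i → i ℕ.< n → k (suc i) < k i
  decreasing = proj₁ enum

  k∈ : ∀ {i} → i ℕ.≤ n → S (k i)
  k∈ {i} i≤n = Equivalence.from (proj₂ enum (k i)) (i , i≤n , refl)

  index : ∀ {j} → S j → ∃ λ i → i ℕ.≤ n × k i ≡ j
  index {j} = Equivalence.to (proj₂ enum j)

  antitone : ∀ {p q} → p ℕ.≤ q → q ℕ.≤ n → k q ≤ k p
  antitone {q = zero}  z≤n _ = ≤-refl
  antitone {q = suc q} p≤1+q 1+q≤n with ℕ.m≤n⇒m<n∨m≡n p≤1+q
  ... | inj₂ refl      = ≤-refl
  ... | inj₁ (s≤s p≤q) = ≤-trans (<⇒≤ (decreasing q 1+q≤n)) (antitone p≤q (ℕ.<⇒≤ 1+q≤n))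

  index-< : ∀ {p q} → p ℕ.≤ n → k q < k p → p ℕ.< q
  index-< p≤n kq<kp = ℕ.≰⇒> λ q≤p → <⇒≱ kq<kp (antitone q≤p p≤n)

isolatedTopGap : ∀ {S m k} → IsDecreasingEnumeration S (suc m) k → TopGapIsSmallest (suc m) k →
                 IsolatedTopGap S
isolatedTopGap {S} {m} {k} enum smallest = record
  { top = k 0 ; next = k 1
  ; top∈ = k∈ z≤n ; next∈ = k∈ (s≤s z≤n)
  ; ≤top = ≤top
  ; <top⇒≤next = <top⇒≤next
  ; gap-unrealised = gap-unrealised
  }
  where
  open DecreasingEnumeration enum
  ≤top : ∀ {j} → S j → j ≤ k 0
  ≤top Sⱼ with index Sⱼ
  ... | i , i≤n , refl = antitone z≤n i≤n
  <top⇒≤next : ∀ {j} → S j → j < k 0 → j ≤ k 1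
  <top⇒≤next Sⱼ j<k₀ with index Sⱼ
  ... | zero  , _   , refl = contradiction j<k₀ (<-irrefl refl)
  ... | suc i , i≤n , refl = antitone (s≤s z≤n) i≤n
  -- x = k p and y = k q with 1 ≤ p < q, so x - y ≥ k p - k (suc p), which exceeds the top gap.
  gap-unrealised : ∀ {x y} → S x → S y → x < k 0 → x - y ≢ k 0 - k 1
  gap-unrealised Sₓ Sᵧ x<k₀ eq with index Sₓ | index Sᵧ
  ... | zero  , _   , refl | _ = <-irrefl refl x<k₀
  ... | suc p , p<n , refl | q , q≤n , refl =
    <-irrefl (sym eq) (<-≤-trans (smallest (suc p) (s≤s z≤n) 1+p<1+m) step-≤)
    where
    p<q : suc p ℕ.< q
    p<q = index-< p<n (≡-difference⇒< eq (decreasing 0 (s≤s z≤n)))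
    1+p<1+m : suc p ℕ.< suc m
    1+p<1+m = ℕ.<-≤-trans p<q q≤n
    step-≤ : k (suc p) - k (suc (suc p)) ≤ k (suc p) - k q
    step-≤ = +-monoʳ-≤ (k (suc p)) (neg-mono-≤ (antitone p<q q≤n))

reverse-enumeration : ∀ {S n k} → IsDecreasingEnumeration S n k →
  IsDecreasingEnumeration (S ∘ -_) n (λ i → - k (n ℕ.∸ i))
reverse-enumeration {S} {n} {k} enum = decreasing′ , λ j → mk⇔ (to j) (from j)
  where
  open DecreasingEnumeration enum
  decreasing′ : ∀ i → i ℕ.< n → - k (n ℕ.∸ suc i) < - k (n ℕ.∸ i)
  decreasing′ i i<n rewrite ∸-suc i<n = neg-mono-< (decreasing (n ℕ.∸ suc i) (ℕ.∸-monoʳ-< ℕ.z<s i<n))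
  to : ∀ j → S (- j) → ∃ λ i → i ℕ.≤ n × - k (n ℕ.∸ i) ≡ j
  to j S₋ⱼ with index S₋ⱼ
  ... | i , i≤n , kᵢ≡-j = n ℕ.∸ i , ℕ.m∸n≤m n i , (begin
    - k (n ℕ.∸ (n ℕ.∸ i)) ≡⟨ cong (-_ ∘ k) (ℕ.m∸[m∸n]≡n i≤n) ⟩
    - k i                 ≡⟨ cong -_ kᵢ≡-j ⟩
    - - j                 ≡⟨ neg-involutive j ⟩
    j                     ∎)
    where open ≡-Reasoning
  from : ∀ j → (∃ λ i → i ℕ.≤ n × - k (n ℕ.∸ i) ≡ j) → S (- j)
  from j (i , _ , refl) = subst S (sym (neg-involutive _)) (k∈ (ℕ.m∸n≤m n i))

reverse-BottomGapIsSmallest : ∀ {m k} → BottomGapIsSmallest m k →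
  TopGapIsSmallest (suc m) (λ i → - k (suc m ℕ.∸ i))
reverse-BottomGapIsSmallest {m} {k} smallest (suc i) _ (s≤s i<m)
  rewrite ∸-suc i<m | -x--y≡y-x (k (suc m)) (k m) | -x--y≡y-x (k (suc (m ℕ.∸ suc i))) (k (m ℕ.∸ suc i))
  = smallest (m ℕ.∸ suc i) (ℕ.∸-monoʳ-< ℕ.z<s i<m)

hyperMonolithic-sumset-singleton : ∀ {S A B m k} → IsSumset S A B → IsDecreasingEnumeration S (suc m) k →
  TopGapIsSmallest (suc m) k ⊎ BottomGapIsSmallest m k → IsSingleton A ⊎ IsSingleton B
hyperMonolithic-sumset-singleton sum enum (inj₁ top) = sumset-singleton sum (isolatedTopGap enum top)
hyperMonolithic-sumset-singleton {k = k} sum enum (inj₂ bottom) =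
  Sum.map IsSingleton-neg IsSingleton-neg
    (sumset-singleton (IsSumset-neg sum)
      (isolatedTopGap (reverse-enumeration enum) (reverse-BottomGapIsSmallest {k = k} bottom)))

IsSingleton⇒IsMonomial : ∀ {g} → IsSingleton (Support g) → IsMonomial g
IsSingleton⇒IsMonomial {g} (c , g꜀≢0 , others) =
  coeff g c , c , ℕ.n≢0⇒n>0 g꜀≢0 , refl , λ j j≢c → decidable-stable (coeff g j ℕ.≟ 0) (others j j≢c)

lemma2p6 : ∀ (f : Laurent) → HyperMonolithic f → Monolithic f
lemma2p6 f (m , k , enum , gaps) =
  (k 0 , DecreasingEnumeration.k∈ enum z≤n) ,
  λ g h f≈gh → Sum.map IsSingleton⇒IsMonomial IsSingleton⇒IsMonomial
                 (hyperMonolithic-sumset-singleton (Support-sumset f≈gh) enum gaps)
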